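{- Let $p$ be a prime number and let $\mathbb{Z}_{(p)}$ be the localization of $\mathbb{Z}$ at $p\mathbb{Z}$. Let $J_1\supseteq J_2\supseteq\cdots$ be a decreasing sequence (finite or infinite) of ideals of $\mathbb{Z}_{(p)}$, indexed by $I=\{1,2,\dots\}$ (or $\{1,\dots,N\}$). Form the cochain complex $$C^n=\prod_{i_0<\cdots<i_n\in I}\mathbb{Z}_{(p)}/J_{i_0},\qquad d:C^{n-1}\to C^n,$$ $$(df)(i_0,\dots,i_n)\equiv\sum_{j=0}^n(-1)^j f(i_0,\dots,\widehat{i_j},\dots,i_n)\pmod{J_{i_0}}.$$ Then $H^n(C)=0$ for all $n>0$.
   Context: $\mathbb{Z}_{(p)}$ is the ring of fractions $a/s$ with $a\in\mathbb{Z}$, $s\in\mathbb{Z}\setminus p\mathbb{Z}$. Since the $J_i$ decrease, $J_{i_1}\subseteq J_{i_0}$ for $i_0<i_1$, so all terms in the formula for $df$ can be reduced modulo $J_{i_0}$. The hat means the entry is omitted. -}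

module Defs where

open import Data.Nat using (ℕ; zero; suc; _≤_; _<_)
open import Data.Nat.Primality using (Prime)
open import Data.Integer using (ℤ; +_)
open import Data.Integer.Divisibility using () renaming (_∣_ to _∣ℤ_)
open import Data.Rational using (ℚ; _/_; _+_; _*_; _-_; -_; 0ℚ; 1ℚ)
open import Data.Fin using (Fin; toℕ)
open import Data.Vec using (Vec; []; _∷_; head; removeAt)
open import Data.Maybe using (Maybe; just; nothing)
open import Data.Product using (Σ-syntax; _×_)
open import Data.Unit using (⊤)
open import Relation.Nullary using (¬_)
open import Relation.Binary.PropositionalEquality using (_≡_)

ι : ℤ → ℚ
ι z = z / 1

-- Z_(p) realised inside ℚ: q lies in Z_(p) iff q = a/s with a ∈ ℤ, s ∈ ℤ, p ∤ s
-- (written as q * s = a, which is q = a/s since p ∤ s forces s ≠ 0)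
InZp : ℕ → ℚ → Set
InZp p q = Σ[ a ∈ ℤ ] Σ[ s ∈ ℤ ] (¬ ((+ p) ∣ℤ s) × (q * ι s ≡ ι a))

record IsIdealZp (p : ℕ) (J : ℚ → Set) : Set where
  field
    sub   : ∀ x → J x → InZp p x
    zero∈ : J 0ℚ
    +-closed : ∀ x y → J x → J y → J (x + y)
    *-closed : ∀ r x → InZp p r → J x → J (r * x)

-- the index set I: {1,2,...} (nothing) or {1,...,N} (just N)
InI : Maybe ℕ → ℕ → Set
InI nothing  i = 1 ≤ i
InI (just N) i = 1 ≤ i × i ≤ N

Increasing : ∀ {n} → Vec ℕ n → Set
Increasing [] = ⊤
Increasing (i ∷ []) = ⊤
Increasing (i ∷ j ∷ t) = i < j × Increasing (j ∷ t)

AllInI : Maybe ℕ → ∀ {n} → Vec ℕ n → Set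
AllInI I [] = ⊤
AllInI I (i ∷ t) = InI I i × AllInI I t

Valid : Maybe ℕ → ∀ {n} → Vec ℕ n → Set
Valid I t = Increasing t × AllInI I t

sgn : ℕ → ℚ
sgn zero = 1ℚ
sgn (suc j) = - sgn j

sumFin : ∀ {n} → (Fin n → ℚ) → ℚ
sumFin {zero} f = 0ℚ
sumFin {suc n} f = f Fin.zero + sumFin (λ j → f (Fin.suc j))

d : ∀ {n} → (Vec ℕ (suc n) → ℚ) → Vec ℕ (suc (suc n)) → ℚ
d f t = sumFin (λ j → sgn (toℕ j) * f (removeAt t j))

-- an n-cochain (n+1 = length of tuples) represented by Z_(p)-valued representatives
IsCochain : ℕ → Maybe ℕ → ∀ {k} → (Vec ℕ k → ℚ) → Set
IsCochain p I f = ∀ t → Valid I t → InZp p (f t)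

{-# OPTIONS --safe #-}
-- Write a tuple as (w, x) with x its last entry and put
--   g(w, x) = (-1)^|w| Σ_{last w < k < x} f(w, k, k+1).
-- For a tuple (v, x) with v = (u, a), the defect dg(v, x) - f(v, x) vanishes at x = a + 1,
-- and passing from x to x + 1 adds (-1)^|u| df(v, x, x+1). Hence the defect equals
-- (-1)^|u| Σ_{a < k < x} df(v, k, k+1), a sum of cocycle values at tuples with the same first
-- index as (v, x), so it lies in the ideal of that index. Primality of p is needed only to
-- know that Z_(p) is a ring, so that g is again a cochain.
module Submission where

open import Defs
open import Algebra.Bundles using (CommutativeRing)
open import Data.Fin using (Fin; toℕ; inject₁; fromℕ)
open import Data.Fin.Properties using (toℕ-inject₁; toℕ-fromℕ)
open import Data.Integer as ℤ using (ℤ; +_)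
open import Data.Integer.Divisibility using () renaming (_∣_ to _∣ℤ_)
import Data.Integer.Properties as ℤ
open import Data.Maybe using (Maybe; just; nothing)
open import Data.Nat as ℕ using (ℕ; zero; suc; _≤_; _<_; z≤n; s≤s; _<?_)
open import Data.Nat.Divisibility using (_∣_; ∣1⇒≡1)
open import Data.Nat.Primality using (Prime; prime⇒nonTrivial; euclidsLemma)
open import Data.Nat.Properties
  using (≤-refl; ≤-reflexive; ≤-trans; <⇒≤; <-irrefl; ≤-<-trans; m<n⇒m<1+n; m<1+n⇒m<n∨m≡n)
open import Data.Product using (Σ-syntax; _×_; _,_; proj₁; proj₂; map; map₁)
open import Data.Rational using (ℚ; _+_; _*_; _-_; -_; 0ℚ; 1ℚ; toℚᵘ; fromℚᵘ)
open import Data.Rational.Properties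
  using (toℚᵘ-injective; toℚᵘ-fromℚᵘ; fromℚᵘ-cong; toℚᵘ-homo-+; toℚᵘ-homo-*; toℚᵘ-homo‿-;
         neg-distribˡ-*; *-identityˡ; *-zeroʳ; *-distribˡ-+; +-inverseʳ; +-*-commutativeRing)
open import Data.Rational.Solver using (module +-*-Solver)
import Data.Rational.Unnormalised as ℚᵘ
import Data.Rational.Unnormalised.Properties as ℚᵘ
open import Data.Sum using (inj₁; inj₂)
open import Data.Unit using (tt)
open import Data.Vec using (Vec; []; _∷_; head; init; last; initLast; removeAt; _∷ʳ_)
open import Data.Vec.Properties using (init-∷ʳ; last-∷ʳ)
open import Level using (Level)
open import Relation.Nullary using (¬_; yes; no; contradiction)
open import Relation.Binary.PropositionalEquality

open import Algebra.Properties.Semiring.Sum (CommutativeRing.semiring +-*-commutativeRing)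
  using (sum; sum-cong-≗; sum-init-last; sum-replicate-zero; ∑-distrib-+; *-distribˡ-sum)
open +-*-Solver using (solve; con; _:+_; _:*_; :-_; _:-_; _:=_)

private
  variable
    a : Level
    A : Set a
    n : ℕ

fromℚᵘ-homo-+ : ∀ p q → fromℚᵘ (p ℚᵘ.+ q) ≡ fromℚᵘ p + fromℚᵘ q
fromℚᵘ-homo-+ p q = toℚᵘ-injective (begin
  toℚᵘ (fromℚᵘ (p ℚᵘ.+ q))              ≈⟨ toℚᵘ-fromℚᵘ (p ℚᵘ.+ q) ⟩
  p ℚᵘ.+ q                              ≈⟨ ℚᵘ.+-cong (toℚᵘ-fromℚᵘ p) (toℚᵘ-fromℚᵘ q) ⟨
  toℚᵘ (fromℚᵘ p) ℚᵘ.+ toℚᵘ (fromℚᵘ q)  ≈⟨ toℚᵘ-homo-+ (fromℚᵘ p) (fromℚᵘ q) ⟨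
  toℚᵘ (fromℚᵘ p + fromℚᵘ q)            ∎)
  where open ℚᵘ.≃-Reasoning

fromℚᵘ-homo-* : ∀ p q → fromℚᵘ (p ℚᵘ.* q) ≡ fromℚᵘ p * fromℚᵘ q
fromℚᵘ-homo-* p q = toℚᵘ-injective (begin
  toℚᵘ (fromℚᵘ (p ℚᵘ.* q))              ≈⟨ toℚᵘ-fromℚᵘ (p ℚᵘ.* q) ⟩
  p ℚᵘ.* q                              ≈⟨ ℚᵘ.*-cong (toℚᵘ-fromℚᵘ p) (toℚᵘ-fromℚᵘ q) ⟨
  toℚᵘ (fromℚᵘ p) ℚᵘ.* toℚᵘ (fromℚᵘ q)  ≈⟨ toℚᵘ-homo-* (fromℚᵘ p) (fromℚᵘ q) ⟨
  toℚᵘ (fromℚᵘ p * fromℚᵘ q)            ∎)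
  where open ℚᵘ.≃-Reasoning

fromℚᵘ-homo‿- : ∀ p → fromℚᵘ (ℚᵘ.- p) ≡ - fromℚᵘ p
fromℚᵘ-homo‿- p = toℚᵘ-injective (begin
  toℚᵘ (fromℚᵘ (ℚᵘ.- p))  ≈⟨ toℚᵘ-fromℚᵘ (ℚᵘ.- p) ⟩
  ℚᵘ.- p                  ≈⟨ ℚᵘ.-‿cong (toℚᵘ-fromℚᵘ p) ⟨
  ℚᵘ.- toℚᵘ (fromℚᵘ p)    ≈⟨ toℚᵘ-homo‿- (fromℚᵘ p) ⟨
  toℚᵘ (- fromℚᵘ p)       ∎)
  where open ℚᵘ.≃-Reasoning

ι-homo-+ : ∀ a b → ι (a ℤ.+ b) ≡ ι a + ι b
ι-homo-+ a b =
  trans (fromℚᵘ-cong {ℚᵘ.mkℚᵘ (a ℤ.+ b) 0} {a′ ℚᵘ.+ b′} (ℚᵘ.*≡* (cong (ℤ._* + 1) a+b≡a*1+b*1)))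
        (fromℚᵘ-homo-+ a′ b′)
  where
  a′ = ℚᵘ.mkℚᵘ a 0
  b′ = ℚᵘ.mkℚᵘ b 0
  a+b≡a*1+b*1 : a ℤ.+ b ≡ a ℤ.* + 1 ℤ.+ b ℤ.* + 1
  a+b≡a*1+b*1 = sym (cong₂ ℤ._+_ (ℤ.*-identityʳ a) (ℤ.*-identityʳ b))

ι-homo-* : ∀ a b → ι (a ℤ.* b) ≡ ι a * ι b
ι-homo-* a b = fromℚᵘ-homo-* (ℚᵘ.mkℚᵘ a 0) (ℚᵘ.mkℚᵘ b 0)

ι-homo‿- : ∀ a → ι (ℤ.- a) ≡ - ι a
ι-homo‿- a = fromℚᵘ-homo‿- (ℚᵘ.mkℚᵘ a 0)

-- Z_(p) is a subring of ℚ

module _ {p : ℕ} (p-prime : Prime p) where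

  p∤1 : ¬ (+ p ∣ℤ + 1)
  p∤1 p∣1 = ℕ.nonTrivial⇒≢1 {{prime⇒nonTrivial p-prime}} (∣1⇒≡1 p∣1)

  p∤-* : ∀ {s t} → ¬ (+ p ∣ℤ s) → ¬ (+ p ∣ℤ t) → ¬ (+ p ∣ℤ s ℤ.* t)
  p∤-* {s} {t} p∤s p∤t p∣st
    with euclidsLemma ℤ.∣ s ∣ ℤ.∣ t ∣ p-prime (subst (p ∣_) (ℤ.abs-* s t) p∣st)
  ... | inj₁ p∣s = p∤s p∣s
  ... | inj₂ p∣t = p∤t p∣t

  InZp-0 : InZp p 0ℚ
  InZp-0 = + 0 , + 1 , p∤1 , refl

  InZp-1 : InZp p 1ℚ
  InZp-1 = + 1 , + 1 , p∤1 , refl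

  InZp-+ : ∀ {q r} → InZp p q → InZp p r → InZp p (q + r)
  InZp-+ {q} {r} (a , s , p∤s , qs≡a) (b , t , p∤t , rt≡b) =
    a ℤ.* t ℤ.+ b ℤ.* s , s ℤ.* t , p∤-* {s} {t} p∤s p∤t , (begin
      (q + r) * ι (s ℤ.* t)                  ≡⟨ cong ((q + r) *_) (ι-homo-* s t) ⟩
      (q + r) * (ι s * ι t)                  ≡⟨ regroup q r (ι s) (ι t) ⟩
      (q * ι s) * ι t + (r * ι t) * ι s      ≡⟨ cong₂ (λ x y → x * ι t + y * ι s) qs≡a rt≡b ⟩
      ι a * ι t + ι b * ι s                  ≡⟨ cong₂ _+_ (ι-homo-* a t) (ι-homo-* b s) ⟨
      ι (a ℤ.* t) + ι (b ℤ.* s)              ≡⟨ ι-homo-+ (a ℤ.* t) (b ℤ.* s) ⟨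
      ι (a ℤ.* t ℤ.+ b ℤ.* s)                ∎)
    where
    open ≡-Reasoning
    regroup : ∀ q r S T → (q + r) * (S * T) ≡ (q * S) * T + (r * T) * S
    regroup = solve 4 (λ q r S T → (q :+ r) :* (S :* T) := (q :* S) :* T :+ (r :* T) :* S) refl

  InZp-* : ∀ {q r} → InZp p q → InZp p r → InZp p (q * r)
  InZp-* {q} {r} (a , s , p∤s , qs≡a) (b , t , p∤t , rt≡b) =
    a ℤ.* b , s ℤ.* t , p∤-* {s} {t} p∤s p∤t , (begin
      (q * r) * ι (s ℤ.* t)      ≡⟨ cong ((q * r) *_) (ι-homo-* s t) ⟩
      (q * r) * (ι s * ι t)      ≡⟨ regroup q r (ι s) (ι t) ⟩
      (q * ι s) * (r * ι t)      ≡⟨ cong₂ _*_ qs≡a rt≡b ⟩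
      ι a * ι b                  ≡⟨ ι-homo-* a b ⟨
      ι (a ℤ.* b)                ∎)
    where
    open ≡-Reasoning
    regroup : ∀ q r S T → (q * r) * (S * T) ≡ (q * S) * (r * T)
    regroup = solve 4 (λ q r S T → (q :* r) :* (S :* T) := (q :* S) :* (r :* T)) refl

  InZp-neg : ∀ {q} → InZp p q → InZp p (- q)
  InZp-neg {q} (a , s , p∤s , qs≡a) =
    ℤ.- a , s , p∤s , trans (sym (neg-distribˡ-* q (ι s))) (trans (cong -_ qs≡a) (sym (ι-homo‿- a)))

  InZp-sgn : ∀ n → InZp p (sgn n)
  InZp-sgn zero    = InZp-1
  InZp-sgn (suc n) = InZp-neg {sgn n} (InZp-sgn n)

removeAt-∷ʳ-fromℕ : (w : Vec A n) (x : A) → removeAt (w ∷ʳ x) (fromℕ n) ≡ w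
removeAt-∷ʳ-fromℕ []           x = refl
removeAt-∷ʳ-fromℕ (y ∷ [])     x = refl
removeAt-∷ʳ-fromℕ (y ∷ z ∷ zs) x = cong (y ∷_) (removeAt-∷ʳ-fromℕ (z ∷ zs) x)

removeAt-∷ʳ-inject₁ : (w : Vec A (suc n)) (x : A) (j : Fin (suc n)) →
                      removeAt (w ∷ʳ x) (inject₁ j) ≡ removeAt w j ∷ʳ x
removeAt-∷ʳ-inject₁ (y ∷ ys)     x Fin.zero    = refl
removeAt-∷ʳ-inject₁ (y ∷ z ∷ zs) x (Fin.suc j) = cong (y ∷_) (removeAt-∷ʳ-inject₁ (z ∷ zs) x j)

∷ʳ-elim : ∀ {b} (P : Vec A (suc n) → Set b) → (∀ w x → P (w ∷ʳ x)) → ∀ t → P t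
∷ʳ-elim P P-∷ʳ t with initLast t
... | w , x , t≡w∷ʳx = subst P (sym t≡w∷ʳx) (P-∷ʳ w x)

head-∷ʳ : (v : Vec A (suc n)) (x : A) → head (v ∷ʳ x) ≡ head v
head-∷ʳ (y ∷ ys) x = refl

sgn-*-sgn : ∀ n x → sgn n * (sgn n * x) ≡ x
sgn-*-sgn zero    x = trans (*-identityˡ (1ℚ * x)) (*-identityˡ x)
sgn-*-sgn (suc n) x = trans (negate-twice (sgn n) x) (sgn-*-sgn n x)
  where
  negate-twice : ∀ s x → - s * (- s * x) ≡ s * (s * x)
  negate-twice = solve 2 (λ s x → :- s :* (:- s :* x) := s :* (s :* x)) refl

-- The coboundary d (see d≡faceSum), also for functions on the empty tuple.
faceSum : (Vec ℕ n → ℚ) → Vec ℕ (suc n) → ℚ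
faceSum F t = sum (λ j → sgn (toℕ j) * F (removeAt t j))

sumFin≡sum : (φ : Fin n → ℚ) → sumFin φ ≡ sum φ
sumFin≡sum {zero}  φ = refl
sumFin≡sum {suc n} φ = cong (_+_ (φ Fin.zero)) (sumFin≡sum (λ j → φ (Fin.suc j)))

d≡faceSum : (F : Vec ℕ (suc n) → ℚ) (t : Vec ℕ (suc (suc n))) → d F t ≡ faceSum F t
d≡faceSum F t = sumFin≡sum (λ j → sgn (toℕ j) * F (removeAt t j))

faceSum-init-last : (F : Vec ℕ n → ℚ) (w : Vec ℕ n) (x : ℕ) →
  faceSum F (w ∷ʳ x) ≡ sum (λ j → sgn (toℕ (inject₁ j)) * F (removeAt (w ∷ʳ x) (inject₁ j))) + sgn n * F w
faceSum-init-last {n} F w x = trans (sum-init-last term)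
  (cong (_+_ (sum (λ j → term (inject₁ j))))
        (cong₂ (λ k u → sgn k * F u) (toℕ-fromℕ n) (removeAt-∷ʳ-fromℕ w x)))
  where
  term : Fin (suc n) → ℚ
  term j = sgn (toℕ j) * F (removeAt (w ∷ʳ x) j)

faceSum-∷ʳ : (F : Vec ℕ (suc n) → ℚ) (w : Vec ℕ (suc n)) (x : ℕ) →
  faceSum F (w ∷ʳ x) ≡ faceSum (λ u → F (u ∷ʳ x)) w + sgn (suc n) * F w
faceSum-∷ʳ {n} F w x = trans (faceSum-init-last F w x) (cong (_+ sgn (suc n) * F w) (sum-cong-≗ pointwise))
  where
  pointwise : ∀ (j : Fin (suc n)) → sgn (toℕ (inject₁ j)) * F (removeAt (w ∷ʳ x) (inject₁ j))
                                  ≡ sgn (toℕ j) * F (removeAt w j ∷ʳ x)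
  pointwise j = cong₂ (λ k u → sgn k * F u) (toℕ-inject₁ j) (removeAt-∷ʳ-inject₁ w x j)

faceSum-linear : ∀ {F G H : Vec ℕ n → ℚ} (c : ℚ) (t : Vec ℕ (suc n)) →
  (∀ j → F (removeAt t j) ≡ G (removeAt t j) + c * H (removeAt t j)) →
  faceSum F t ≡ faceSum G t + c * faceSum H t
faceSum-linear {n} {F} {G} {H} c t F≡G+cH = begin
  faceSum F t                  ≡⟨ sum-cong-≗ pointwise ⟩
  sum (λ j → g j + c * h j)    ≡⟨ ∑-distrib-+ g (λ j → c * h j) ⟩
  sum g + sum (λ j → c * h j)  ≡⟨ cong (_+_ (sum g)) (*-distribˡ-sum c h) ⟨
  sum g + c * sum h            ∎
  where
  open ≡-Reasoning
  g h : Fin (suc n) → ℚ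
  g j = sgn (toℕ j) * G (removeAt t j)
  h j = sgn (toℕ j) * H (removeAt t j)
  distrib : ∀ s x c y → s * (x + c * y) ≡ s * x + c * (s * y)
  distrib = solve 4 (λ s x c y → s :* (x :+ c :* y) := s :* x :+ c :* (s :* y)) refl
  pointwise : ∀ j → sgn (toℕ j) * F (removeAt t j) ≡ g j + c * h j
  pointwise j = trans (cong (sgn (toℕ j) *_) (F≡G+cH j))
                      (distrib (sgn (toℕ j)) (G (removeAt t j)) c (H (removeAt t j)))

sumBetween : ℕ → (ℕ → ℚ) → ℕ → ℚ
sumBetween b F zero = 0ℚ
sumBetween b F (suc k) with b <? k
... | yes _ = sumBetween b F k + F k
... | no  _ = 0ℚ

sumBetween-empty : ∀ b F → sumBetween b F (suc b) ≡ 0ℚ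
sumBetween-empty b F with b <? b
... | yes b<b = contradiction b<b (<-irrefl refl)
... | no  _   = refl

sumBetween-suc : ∀ {b k} F → b < k → sumBetween b F (suc k) ≡ sumBetween b F k + F k
sumBetween-suc {b} {k} F b<k with b <? k
... | yes _   = refl
... | no  b≮k = contradiction b<k b≮k

sumBetween-closed : (P : ℚ → Set) → P 0ℚ → (∀ x y → P x → P y → P (x + y)) →
                    ∀ {b F} x → (∀ k → b < k → k < x → P (F k)) → P (sumBetween b F x)
sumBetween-closed P P0 P+ zero PF = P0
sumBetween-closed P P0 P+ {b} (suc k) PF with b <? k
... | yes b<k = P+ _ _ (sumBetween-closed P P0 P+ k (λ j b<j j<k → PF j b<j (m<n⇒m<1+n j<k)))
                       (PF k b<k ≤-refl)
... | no  _   = P0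

-- Indices are at least 1, so 0 can serve as the last entry of the empty tuple.
lastOr0 : Vec ℕ n → ℕ
lastOr0 w = last (0 ∷ w)

lastOr0-∷ʳ : (w : Vec ℕ n) (x : ℕ) → lastOr0 (w ∷ʳ x) ≡ x
lastOr0-∷ʳ w x = last-∷ʳ x (0 ∷ w)

lastOr0-removeAt-inject₁ : (u : Vec ℕ n) (a : ℕ) (j : Fin n) →
                           lastOr0 (removeAt (u ∷ʳ a) (inject₁ j)) ≡ a
lastOr0-removeAt-inject₁ (y ∷ ys) a j =
  trans (cong lastOr0 (removeAt-∷ʳ-inject₁ (y ∷ ys) a j)) (lastOr0-∷ʳ (removeAt (y ∷ ys) j) a)

lastOr0-removeAt≤ : (v : Vec ℕ (suc n)) (j : Fin (suc n)) → Increasing v →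
                    lastOr0 (removeAt v j) ≤ lastOr0 v
lastOr0-removeAt≤ (x ∷ [])         Fin.zero           _          = z≤n
lastOr0-removeAt≤ (x ∷ y ∷ ys)     Fin.zero           _          = ≤-refl
lastOr0-removeAt≤ (x ∷ y ∷ [])     (Fin.suc Fin.zero) (x<y , _)  = <⇒≤ x<y
lastOr0-removeAt≤ (x ∷ y ∷ z ∷ zs) (Fin.suc j)        (_ , incr) = lastOr0-removeAt≤ (y ∷ z ∷ zs) j incr

InI⇒1≤ : ∀ I {x} → InI I x → 1 ≤ x
InI⇒1≤ nothing  1≤x       = 1≤x
InI⇒1≤ (just N) (1≤x , _) = 1≤x

InI-between : ∀ I {k x} → InI I x → 1 ≤ k → k ≤ x → InI I k
InI-between nothing  _         1≤k _   = 1≤k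
InI-between (just N) (_ , x≤N) 1≤k k≤x = 1≤k , ≤-trans k≤x x≤N

AllInI-head : ∀ I (v : Vec ℕ (suc n)) → AllInI I v → InI I (head v)
AllInI-head I (y ∷ ys) (iy , _) = iy

Valid-∷ʳ⁻ : ∀ I (w : Vec ℕ n) x → Valid I (w ∷ʳ x) → Valid I w × lastOr0 w < x × InI I x
Valid-∷ʳ⁻ I []           x (_ , ix , _)                  = (tt , tt) , InI⇒1≤ I ix , ix
Valid-∷ʳ⁻ I (y ∷ [])     x ((y<x , _) , iy , ix , _)     = (tt , iy , tt) , y<x , ix
Valid-∷ʳ⁻ I (y ∷ z ∷ zs) x ((y<z , incr) , iy , allInI) =
  map₁ (map (y<z ,_) (iy ,_)) (Valid-∷ʳ⁻ I (z ∷ zs) x (incr , allInI))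

Valid-∷ʳ⁺ : ∀ I (w : Vec ℕ n) x → Valid I w → lastOr0 w < x → InI I x → Valid I (w ∷ʳ x)
Valid-∷ʳ⁺ I []           x _                          _   ix = tt , ix , tt
Valid-∷ʳ⁺ I (y ∷ [])     x (_ , iy , _)               y<x ix = (y<x , tt) , iy , ix , tt
Valid-∷ʳ⁺ I (y ∷ z ∷ zs) x ((y<z , incr) , iy , allInI) w<x ix =
  map (y<z ,_) (iy ,_) (Valid-∷ʳ⁺ I (z ∷ zs) x (incr , allInI) w<x ix)

Valid-∷ʳ-∷ʳ-suc : ∀ I (w : Vec ℕ n) {k} x → Valid I (w ∷ʳ x) → lastOr0 w < k → k < x →
                  Valid I (w ∷ʳ k ∷ʳ suc k)
Valid-∷ʳ-∷ʳ-suc I w {k} x wx-valid w<k k<x =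
  Valid-∷ʳ⁺ I (w ∷ʳ k) (suc k)
    (Valid-∷ʳ⁺ I w k w-valid w<k (InI-between I ix (≤-trans (s≤s z≤n) w<k) (<⇒≤ k<x)))
    (≤-reflexive (cong suc (lastOr0-∷ʳ w k)))
    (InI-between I ix (s≤s z≤n) k<x)
  where
  w-valid = proj₁ (Valid-∷ʳ⁻ I w x wx-valid)
  ix      = proj₂ (proj₂ (Valid-∷ʳ⁻ I w x wx-valid))

-- The cobounding cochain

module Cobounding {m : ℕ} (f : Vec ℕ (suc (suc m)) → ℚ) where

  s : ℚ
  s = sgn m

  f-step : Vec ℕ m → ℕ → ℚ
  f-step w k = f (w ∷ʳ k ∷ʳ suc k)

  cobounding : Vec ℕ (suc m) → ℚ
  cobounding t = s * sumBetween (lastOr0 (init t)) (f-step (init t)) (last t)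

  cobounding-∷ʳ : ∀ w x → cobounding (w ∷ʳ x) ≡ s * sumBetween (lastOr0 w) (f-step w) x
  cobounding-∷ʳ w x rewrite init-∷ʳ x w | last-∷ʳ x w = refl

  cobounding-empty : ∀ w → cobounding (w ∷ʳ suc (lastOr0 w)) ≡ 0ℚ
  cobounding-empty w = trans (cobounding-∷ʳ w _)
    (trans (cong (s *_) (sumBetween-empty (lastOr0 w) (f-step w))) (*-zeroʳ s))

  cobounding-suc : ∀ w {k} → lastOr0 w < k → cobounding (w ∷ʳ suc k) ≡ cobounding (w ∷ʳ k) + s * f-step w k
  cobounding-suc w {k} w<k = begin
    cobounding (w ∷ʳ suc k)                     ≡⟨ cobounding-∷ʳ w (suc k) ⟩
    s * sumBetween (lastOr0 w) F (suc k)        ≡⟨ cong (s *_) (sumBetween-suc F w<k) ⟩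
    s * (sumBetween (lastOr0 w) F k + F k)      ≡⟨ *-distribˡ-+ s (sumBetween (lastOr0 w) F k) (F k) ⟩
    s * sumBetween (lastOr0 w) F k + s * F k    ≡⟨ cong (_+ s * F k) (cobounding-∷ʳ w k) ⟨
    cobounding (w ∷ʳ k) + s * F k               ∎
    where
    open ≡-Reasoning
    F = f-step w

  cobounding-face-empty : ∀ u a j → cobounding (removeAt (u ∷ʳ a) (inject₁ j) ∷ʳ suc a) ≡ 0ℚ
  cobounding-face-empty u a j = subst (λ b → cobounding (removeAt (u ∷ʳ a) (inject₁ j) ∷ʳ suc b) ≡ 0ℚ)
    (lastOr0-removeAt-inject₁ u a j) (cobounding-empty (removeAt (u ∷ʳ a) (inject₁ j)))

  df-step : Vec ℕ (suc m) → ℕ → ℚ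
  df-step v k = faceSum f (v ∷ʳ k ∷ʳ suc k)

  defect : Vec ℕ (suc m) → ℕ → ℚ
  defect v x = faceSum cobounding (v ∷ʳ x) - f (v ∷ʳ x)

  defect-base : ∀ u a → lastOr0 u < a → defect (u ∷ʳ a) (suc a) ≡ 0ℚ
  defect-base u a u<a = begin
    faceSum cobounding (u ∷ʳ a ∷ʳ suc a) - F
      ≡⟨ cong (_- F) (faceSum-∷ʳ cobounding (u ∷ʳ a) (suc a)) ⟩
    (faceSum (λ w → cobounding (w ∷ʳ suc a)) (u ∷ʳ a) + - s * G) - F
      ≡⟨ cong (λ z → (z + - s * G) - F) (faceSum-init-last (λ w → cobounding (w ∷ʳ suc a)) u a) ⟩
    ((sum inner + s * cobounding (u ∷ʳ suc a)) + - s * G) - F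
      ≡⟨ cong₂ (λ z y → ((z + s * y) + - s * G) - F) inner-vanishes (cobounding-suc u u<a) ⟩
    ((0ℚ + s * (G + s * F)) + - s * G) - F
      ≡⟨ cancel s G F ⟩
    s * (s * F) - F
      ≡⟨ cong (_- F) (sgn-*-sgn m F) ⟩
    F - F
      ≡⟨ +-inverseʳ F ⟩
    0ℚ ∎
    where
    open ≡-Reasoning
    G = cobounding (u ∷ʳ a)
    F = f-step u a
    inner : Fin m → ℚ
    inner j = sgn (toℕ (inject₁ j)) * cobounding (removeAt (u ∷ʳ a) (inject₁ j) ∷ʳ suc a)
    inner-vanishes : sum inner ≡ 0ℚ
    inner-vanishes = trans (sum-cong-≗ λ j →
        trans (cong (sgn (toℕ (inject₁ j)) *_) (cobounding-face-empty u a j)) (*-zeroʳ (sgn (toℕ (inject₁ j)))))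
      (sum-replicate-zero m)
    cancel : ∀ s G F → ((0ℚ + s * (G + s * F)) + - s * G) - F ≡ s * (s * F) - F
    cancel = solve 3 (λ s G F → ((con 0ℚ :+ s :* (G :+ s :* F)) :+ :- s :* G) :- F := s :* (s :* F) :- F) refl

  defect-suc : ∀ v {k} → Increasing v → lastOr0 v < k → defect v (suc k) ≡ defect v k + s * df-step v k
  defect-suc v {k} v-incr v<k = sym (begin
    defect v k + s * df-step v k
      ≡⟨ cong₂ (λ x y → (x - F₀) + s * y) (faceSum-∷ʳ cobounding v k) df-expansion ⟩
    ((Gₖ + - s * G) - F₀) + s * ((Σf + - s * F₁) + - - s * F₀)
      ≡⟨ distribute s Gₖ G F₀ Σf F₁ ⟩
    ((Gₖ + - s * G) - F₀) + ((s * Σf - s * (s * F₁)) + s * (s * F₀))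
      ≡⟨ cong₂ (λ y z → ((Gₖ + - s * G) - F₀) + ((s * Σf - y) + z)) (sgn-*-sgn m F₁) (sgn-*-sgn m F₀) ⟩
    ((Gₖ + - s * G) - F₀) + ((s * Σf - F₁) + F₀)
      ≡⟨ collect s Gₖ G F₀ Σf F₁ ⟩
    ((Gₖ + s * Σf) + - s * G) - F₁
      ≡⟨ cong (λ z → (z + - s * G) - F₁) faces-suc ⟨
    (faceSum (λ w → cobounding (w ∷ʳ suc k)) v + - s * G) - F₁
      ≡⟨ cong (_- F₁) (faceSum-∷ʳ cobounding v (suc k)) ⟨
    defect v (suc k) ∎)
    where
    open ≡-Reasoning
    G  = cobounding v
    F₀ = f (v ∷ʳ k)
    F₁ = f (v ∷ʳ suc k)
    Gₖ = faceSum (λ w → cobounding (w ∷ʳ k)) v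
    Σf = faceSum (λ w → f-step w k) v
    df-expansion : df-step v k ≡ (Σf + - s * F₁) + - - s * F₀
    df-expansion = trans (faceSum-∷ʳ f (v ∷ʳ k) (suc k))
                         (cong (_+ - - s * F₀) (faceSum-∷ʳ (λ w → f (w ∷ʳ suc k)) v k))
    faces-suc : faceSum (λ w → cobounding (w ∷ʳ suc k)) v ≡ Gₖ + s * Σf
    faces-suc = faceSum-linear {F = λ w → cobounding (w ∷ʳ suc k)} {λ w → cobounding (w ∷ʳ k)}
                               {λ w → f-step w k} s v (λ j → cobounding-suc (removeAt v j) (≤-<-trans (lastOr0-removeAt≤ v j v-incr) v<k))
    distribute : ∀ s Gₖ G F₀ Σf F₁ → ((Gₖ + - s * G) - F₀) + s * ((Σf + - s * F₁) + - - s * F₀)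
                                   ≡ ((Gₖ + - s * G) - F₀) + ((s * Σf - s * (s * F₁)) + s * (s * F₀))
    distribute = solve 6 (λ s Gₖ G F₀ Σf F₁ →
      ((Gₖ :+ :- s :* G) :- F₀) :+ s :* ((Σf :+ :- s :* F₁) :+ :- (:- s) :* F₀)
      := ((Gₖ :+ :- s :* G) :- F₀) :+ ((s :* Σf :- s :* (s :* F₁)) :+ s :* (s :* F₀))) refl
    collect : ∀ s Gₖ G F₀ Σf F₁ → ((Gₖ + - s * G) - F₀) + ((s * Σf - F₁) + F₀)
                                ≡ ((Gₖ + s * Σf) + - s * G) - F₁
    collect = solve 6 (λ s Gₖ G F₀ Σf F₁ →
      ((Gₖ :+ :- s :* G) :- F₀) :+ ((s :* Σf :- F₁) :+ F₀) := ((Gₖ :+ s :* Σf) :+ :- s :* G) :- F₁) refl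

  defect-formula : ∀ u a {x} → Increasing (u ∷ʳ a) → lastOr0 u < a → a < x →
                   defect (u ∷ʳ a) x ≡ s * sumBetween a (df-step (u ∷ʳ a)) x
  defect-formula u a {suc x} ua-incr u<a a<1+x with m<1+n⇒m<n∨m≡n a<1+x
  ... | inj₂ refl = trans (defect-base u a u<a)
                          (sym (trans (cong (s *_) (sumBetween-empty a (df-step (u ∷ʳ a)))) (*-zeroʳ s)))
  ... | inj₁ a<x = begin
    defect (u ∷ʳ a) (suc x)          ≡⟨ defect-suc (u ∷ʳ a) ua-incr ua<x ⟩
    defect (u ∷ʳ a) x + s * D x      ≡⟨ cong (_+ s * D x) (defect-formula u a ua-incr u<a a<x) ⟩
    s * sumBetween a D x + s * D x   ≡⟨ *-distribˡ-+ s (sumBetween a D x) (D x) ⟨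
    s * (sumBetween a D x + D x)     ≡⟨ cong (s *_) (sumBetween-suc D a<x) ⟨
    s * sumBetween a D (suc x)       ∎
    where
    open ≡-Reasoning
    D = df-step (u ∷ʳ a)
    ua<x = subst (_< x) (sym (lastOr0-∷ʳ u a)) a<x

module _ {p : ℕ} (p-prime : Prime p) {I : Maybe ℕ} {m : ℕ} (f : Vec ℕ (suc (suc m)) → ℚ) where
  open Cobounding f

  cobounding-isCochain : IsCochain p I f → IsCochain p I cobounding
  cobounding-isCochain f-cochain = ∷ʳ-elim (λ t → Valid I t → InZp p (cobounding t)) λ w x wx-valid →
    subst (InZp p) (sym (cobounding-∷ʳ w x))
      (InZp-* p-prime {s} (InZp-sgn p-prime m)
        (sumBetween-closed (InZp p) (InZp-0 p-prime) (λ q r → InZp-+ p-prime {q} {r}) x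
          (λ k w<k k<x → f-cochain _ (Valid-∷ʳ-∷ʳ-suc I w x wx-valid w<k k<x))))

  module _ {J : ℕ → ℚ → Set} (ideal : ∀ i → InI I i → IsIdealZp p (J i))
           (f-cocycle : ∀ t → Valid I t → J (head t) (d f t)) where

    cobounding-bounds-∷ʳ-∷ʳ : ∀ u a x → Valid I (u ∷ʳ a ∷ʳ x) →
      J (head (u ∷ʳ a ∷ʳ x)) (d cobounding (u ∷ʳ a ∷ʳ x) - f (u ∷ʳ a ∷ʳ x))
    cobounding-bounds-∷ʳ-∷ʳ u a x t-valid = subst (J i₀) (sym defect≡)
      (*-closed s _ (InZp-sgn p-prime m) (sumBetween-closed (J i₀) zero∈ +-closed x cocycle-value))
      where
      i₀ = head (u ∷ʳ a ∷ʳ x)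
      open IsIdealZp (ideal i₀ (AllInI-head I (u ∷ʳ a ∷ʳ x) (proj₂ t-valid)))
      ua-valid = proj₁ (Valid-∷ʳ⁻ I (u ∷ʳ a) x t-valid)
      u<a      = proj₁ (proj₂ (Valid-∷ʳ⁻ I u a ua-valid))
      a<x      = subst (_< x) (lastOr0-∷ʳ u a) (proj₁ (proj₂ (Valid-∷ʳ⁻ I (u ∷ʳ a) x t-valid)))
      D = df-step (u ∷ʳ a)
      defect≡ : d cobounding (u ∷ʳ a ∷ʳ x) - f (u ∷ʳ a ∷ʳ x) ≡ s * sumBetween a D x
      defect≡ = trans (cong (_- f (u ∷ʳ a ∷ʳ x)) (d≡faceSum cobounding (u ∷ʳ a ∷ʳ x)))
                      (defect-formula u a (proj₁ ua-valid) u<a a<x)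
      cocycle-value : ∀ k → a < k → k < x → J i₀ (D k)
      cocycle-value k a<k k<x = subst₂ J same-head (d≡faceSum f (u ∷ʳ a ∷ʳ k ∷ʳ suc k))
        (f-cocycle _ (Valid-∷ʳ-∷ʳ-suc I (u ∷ʳ a) x t-valid (subst (_< k) (sym (lastOr0-∷ʳ u a)) a<k) k<x))
        where
        same-head : head (u ∷ʳ a ∷ʳ k ∷ʳ suc k) ≡ i₀
        same-head = trans (head-∷ʳ (u ∷ʳ a ∷ʳ k) (suc k))
                          (trans (head-∷ʳ (u ∷ʳ a) k) (sym (head-∷ʳ (u ∷ʳ a) x)))

    cobounding-bounds : ∀ t → Valid I t → J (head t) (d cobounding t - f t)
    cobounding-bounds = ∷ʳ-elim Bounds λ v x →
      ∷ʳ-elim (λ v → Bounds (v ∷ʳ x)) (λ u a → cobounding-bounds-∷ʳ-∷ʳ u a x) v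
      where
      Bounds : Vec ℕ (suc (suc m)) → Set
      Bounds t = Valid I t → J (head t) (d cobounding t - f t)

proposition2 : (p : ℕ) → Prime p → (I : Maybe ℕ) → (J : ℕ → ℚ → Set)
    → (∀ i → InI I i → IsIdealZp p (J i))
    → (∀ i → InI I i → InI I (suc i) → ∀ x → J (suc i) x → J i x)
    → ∀ (m : ℕ) (f : Vec ℕ (suc (suc m)) → ℚ)
    → IsCochain p I f
    → (∀ t → Valid I t → J (head t) (d f t))
    → Σ[ g ∈ (Vec ℕ (suc m) → ℚ) ]
    (IsCochain p I g × (∀ t → Valid I t → J (head t) (d g t - f t)))
proposition2 p p-prime I J ideal _ m f f-cochain f-cocycle =
  Cobounding.cobounding f ,
  cobounding-isCochain p-prime f f-cochain ,
  cobounding-bounds p-prime f ideal f-cocycle
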